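{- Let $k\ge4$ and let $L$ be a $(2k-1,2)$-near-uniform list assignment of the complete graph $K_{k-1}$. Then $K_{k-1}$ has an $L$-$(2k-1,2)$-colouring.
   Context: $G_{2k-1,2}$ is the graph on $\{0,\dots,2k-2\}$ with $ij$ an edge iff $2\le|i-j|\le 2k-3$; $N(a)$ denotes the neighbourhood of $a$ in it. A list assignment $L$ of a graph is $(2k-1,2)$-near-uniform if there are two distinct non-adjacent vertices $a,b$ of $G_{2k-1,2}$ such that every vertex's list is either $N(a)$ or $N(b)$, and both lists occur (so $L$ is not uniform). An $L$-$(2k-1,2)$-colouring is a map $f$ with $f(v)\in L(v)$ for all $v$ that is a homomorphism to $G_{2k-1,2}$, i.e. $2\le|f(u)-f(v)|\le2k-3$ for every edge $uv$. -}

module Defs where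

open import Data.Nat using (ℕ; suc; _+_; _*_; _∸_; _≤_; ∣_-_∣)
open import Data.Fin using (Fin; toℕ)
open import Data.Product using (_×_; ∃-syntax)
open import Data.Sum using (_⊎_)
open import Relation.Binary.PropositionalEquality using (_≡_)
open import Relation.Nullary using (¬_)

GAdj : (k : ℕ) → Fin (2 * k ∸ 1) → Fin (2 * k ∸ 1) → Set
GAdj k i j = 2 ≤ ∣ toℕ i - toℕ j ∣ × ∣ toℕ i - toℕ j ∣ ≤ 2 * k ∸ 3

InN : (k : ℕ) → Fin (2 * k ∸ 1) → Fin (2 * k ∸ 1) → Set
InN k a c = GAdj k a c

KAdj : (n : ℕ) → Fin n → Fin n → Set
KAdj n u v = ¬ (u ≡ v)

-- A list assignment of K_{k-1} whose lists are neighbourhoods N(·) in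
-- G_{2k-1,2} is represented by the centre: vertex v gets list N(L v).
-- (2k-1,2)-near-uniform: there are distinct non-adjacent a, b with every
-- list equal to N(a) or N(b), and both occurring.
NearUniform : (k : ℕ) → (Fin (k ∸ 1) → Fin (2 * k ∸ 1)) → Set
NearUniform k L =
  ∃[ a ] ∃[ b ]
    ( ¬ (a ≡ b) × ¬ GAdj k a b
    × (∀ v → L v ≡ a ⊎ L v ≡ b)
    × (∃[ v ] L v ≡ a) × (∃[ w ] L w ≡ b))

LColouring : (k : ℕ) → (Fin (k ∸ 1) → Fin (2 * k ∸ 1)) →
             (Fin (k ∸ 1) → Fin (2 * k ∸ 1)) → Set
LColouring k L f =
  (∀ v → InN k (L v) (f v))
  × (∀ u v → KAdj (k ∸ 1) u v → GAdj k (f u) (f v))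

-- The two lists are N(p) and N(p + 1) for some p, since non-adjacent vertices
-- of G_{2k-1,2} are consecutive on the cycle ℤ_{2k-1}. The k - 1 colours
-- p + 2, p + 4, …, p + 2(k - 1) are pairwise at cyclic distance at least 2;
-- all but the last lie in N(p) and all but the first in N(p + 1). So it
-- suffices to order the vertices with an N(p)-vertex first and an
-- N(p + 1)-vertex last, and give the i-th vertex the i-th colour.
module Submission where

open import Defs
open import Data.Nat using (ℕ; _*_; _∸_; _≤_)
open import Data.Fin using (Fin)
open import Data.Product using (∃-syntax)

open import Data.Nat using (suc; zero; _+_; _<_; s≤s; s≤s⁻¹; z≤n; _<?_; ∣_-_∣)
open import Data.Nat.Properties
open import Data.Nat.Tactic.RingSolver using (solve-∀)
open import Data.Fin as Fin using (toℕ; fromℕ; fromℕ<)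
open import Data.Fin.Properties using (toℕ-injective; toℕ<n; toℕ-fromℕ<; toℕ-fromℕ; ≤fromℕ)
import Data.Fin.Properties as Finₚ
open import Data.Fin.Permutation using (Permutation′; _⟨$⟩ʳ_; _⟨$⟩ˡ_; inverseˡ; transpose; _∘ₚ_)
open import Function using (_∘_)
open import Data.Product using (_,_; _×_; proj₂)
open import Data.Sum using (_⊎_; inj₁; inj₂)
import Data.Sum as Sum
open import Relation.Binary.PropositionalEquality
open import Relation.Binary.Definitions using (tri<; tri≈; tri>)
open import Relation.Nullary using (¬_; yes; no)
open import Relation.Nullary.Decidable using (dec-true; dec-false)
open import Data.Empty using (⊥-elim)

-- Reduction modulo N of a number below 2N.
wrap : ℕ → ℕ → ℕ
wrap N y with y <? N
... | yes _ = y
... | no  _ = y ∸ N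

wrap-< : ∀ {N y} → y < N → wrap N y ≡ y
wrap-< {N} {y} y<N with y <? N
... | yes _   = refl
... | no  y≮N = ⊥-elim (y≮N y<N)

wrap-≥ : ∀ {N y} → N ≤ y → wrap N y ≡ y ∸ N
wrap-≥ {N} {y} N≤y with y <? N
... | yes y<N = ⊥-elim (<⇒≱ y<N N≤y)
... | no  _   = refl

wrap-<N : ∀ N y → y < N + N → wrap N y < N
wrap-<N N y y<2N with y <? N
... | yes y<N = y<N
... | no  y≮N = +-cancelʳ-< _ _ N (subst (_< N + N) (sym (m∸n+n≡m (≮⇒≥ y≮N))) y<2N)

-- Residues i, j < N are adjacent in the complement of the cycle C_N
-- exactly when Far N ∣ i - j ∣.
Far : ℕ → ℕ → Set
Far N d = 2 ≤ d × d ≤ N ∸ 2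

far : ∀ {N d} → 2 ≤ d → d + 2 ≤ N → Far N d
far {d = d} 2≤d d+2≤N = 2≤d , m+n≤o⇒m≤o∸n d d+2≤N

far-∸ : ∀ {N d} → Far N d → Far N (N ∸ d)
far-∸ {N} {d} (2≤d , d≤N∸2) =
  m+n≤o⇒m≤o∸n 2 (subst (_≤ N) (+-comm d 2) d+2≤N) , ∸-monoʳ-≤ N 2≤d
  where
  d+2≤N : d + 2 ≤ N
  d+2≤N = m≤o∸n⇒m+n≤o d (≤-trans (≤-trans 2≤d d≤N∸2) (m∸n≤m N 2)) d≤N∸2

wrap-shift-distance : ∀ N x d → d ≤ N →
  ∣ wrap N x - wrap N (x + d) ∣ ≡ d ⊎ ∣ wrap N x - wrap N (x + d) ∣ ≡ N ∸ d
wrap-shift-distance N x d d≤N with <-≤-connex (x + d) N | <-≤-connex x N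
... | inj₁ x+d<N | _ = inj₁ (begin
  ∣ wrap N x - wrap N (x + d) ∣ ≡⟨ cong₂ ∣_-_∣ (wrap-< (≤-<-trans (m≤m+n x d) x+d<N)) (wrap-< x+d<N) ⟩
  ∣ x - x + d ∣                 ≡⟨ ∣m-m+n∣≡n x d ⟩
  d                             ∎)
  where open ≡-Reasoning
... | inj₂ N≤x+d | inj₁ x<N = inj₂ (begin
  ∣ wrap N x - wrap N (x + d) ∣ ≡⟨ cong₂ ∣_-_∣ (wrap-< x<N) (wrap-≥ N≤x+d) ⟩
  ∣ x - e ∣                     ≡⟨ cong ∣_- e ∣ x≡N∸d+e ⟩
  ∣ (N ∸ d) + e - e ∣           ≡⟨ ∣-∣-comm (N ∸ d + e) e ⟩
  ∣ e - (N ∸ d) + e ∣           ≡⟨ cong ∣ e -_∣ (+-comm (N ∸ d) e) ⟩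
  ∣ e - e + (N ∸ d) ∣           ≡⟨ ∣m-m+n∣≡n e (N ∸ d) ⟩
  N ∸ d                         ∎)
  where
  open ≡-Reasoning
  e : ℕ
  e = x + d ∸ N
  x≡N∸d+e : x ≡ (N ∸ d) + e
  x≡N∸d+e = +-cancelʳ-≡ d x (N ∸ d + e) (begin
    x + d             ≡⟨ m∸n+n≡m N≤x+d ⟨
    e + N             ≡⟨ cong (e +_) (m∸n+n≡m d≤N) ⟨
    e + (N ∸ d + d)   ≡⟨ +-assoc e (N ∸ d) d ⟨
    e + (N ∸ d) + d   ≡⟨ cong (_+ d) (+-comm e (N ∸ d)) ⟩
    N ∸ d + e + d     ∎)
... | inj₂ _ | inj₂ N≤x = inj₁ (begin
  ∣ wrap N x - wrap N (x + d) ∣ ≡⟨ cong₂ ∣_-_∣ (wrap-≥ N≤x) (wrap-≥ (≤-trans N≤x (m≤m+n x d))) ⟩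
  ∣ x ∸ N - x + d ∸ N ∣         ≡⟨ cong ∣ x ∸ N -_∣ (+-∸-comm d N≤x) ⟩
  ∣ x ∸ N - x ∸ N + d ∣         ≡⟨ ∣m-m+n∣≡n (x ∸ N) d ⟩
  d                             ∎)
  where open ≡-Reasoning

wrap-shift-far : ∀ {N d} x → Far N d → Far N ∣ wrap N x - wrap N (x + d) ∣
wrap-shift-far {N} {d} x far-d with wrap-shift-distance N x d (≤-trans (proj₂ far-d) (m∸n≤m N 2))
... | inj₁ eq = subst (Far N) (sym eq) far-d
... | inj₂ eq = subst (Far N) (sym eq) (far-∸ far-d)

module Palette {N M : ℕ} (M+M<N : M + M < N) {p : ℕ} (p<N : p < N) where

  colour : ℕ → ℕ
  colour i = wrap N (p + (2 + (i + i)))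

  double<N : ∀ {i} → i ≤ M → i + i < N
  double<N i≤M = ≤-<-trans (+-mono-≤ i≤M i≤M) M+M<N

  colour<N : ∀ {i} → i < M → colour i < N
  colour<N {i} i<M =
    wrap-<N N _ (+-mono-<-≤ p<N (<⇒≤ (subst (_< N) (double-suc i) (double<N i<M))))
    where
    double-suc : ∀ i → suc i + suc i ≡ 2 + (i + i)
    double-suc = solve-∀

  colour-far-from-p : ∀ {i} → suc i < M → Far N ∣ p - colour i ∣
  colour-far-from-p {i} 1+i<M =
    subst (λ z → Far N ∣ z - colour i ∣) (wrap-< p<N)
      (wrap-shift-far {N} p (far (s≤s (s≤s z≤n))
        (subst (_≤ N) (sym (offset+2 i)) (<⇒≤ (double<N 1+i<M)))))
    where
    offset+2 : ∀ i → 2 + (i + i) + 2 ≡ (2 + i) + (2 + i)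
    offset+2 = solve-∀

  colour-far-from-suc-p : ∀ {i} → 1 ≤ i → i < M → Far N ∣ wrap N (suc p) - colour i ∣
  colour-far-from-suc-p {i} 1≤i i<M =
    subst (λ z → Far N ∣ wrap N (suc p) - wrap N z ∣) (sym (shift p i))
      (wrap-shift-far {N} (suc p) (far (s≤s (≤-trans 1≤i (m≤m+n i i)))
        (subst (_≤ N) (sym (offset+2 i)) (double<N i<M))))
    where
    shift : ∀ p i → p + (2 + (i + i)) ≡ suc p + (1 + (i + i))
    shift = solve-∀
    offset+2 : ∀ i → 1 + (i + i) + 2 ≡ suc ((1 + i) + (1 + i))
    offset+2 = solve-∀

  colour-far-shift : ∀ i e → suc i + e < M → Far N ∣ colour i - colour (suc i + e) ∣
  colour-far-shift i e j<M =
    subst (λ z → Far N ∣ colour i - wrap N z ∣) (sym (shift p i e))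
      (wrap-shift-far {N} (p + (2 + (i + i))) (far (s≤s (≤-trans (s≤s z≤n) (m≤n+m (suc e) e)))
        (subst (_≤ N) (sym (gap+2 e))
          (<⇒≤ (double<N (≤-trans (s≤s (s≤s (m≤n+m e i))) j<M))))))
    where
    shift : ∀ p i e → p + (2 + ((suc i + e) + (suc i + e))) ≡ p + (2 + (i + i)) + (suc e + suc e)
    shift = solve-∀
    gap+2 : ∀ e → suc e + suc e + 2 ≡ (2 + e) + (2 + e)
    gap+2 = solve-∀

  colour-far-< : ∀ {i j} → i < j → j < M → Far N ∣ colour i - colour j ∣
  colour-far-< {i} {j} i<j j<M =
    subst (λ z → Far N ∣ colour i - colour z ∣) i+gap≡j
      (colour-far-shift i (j ∸ suc i) (subst (_< M) (sym i+gap≡j) j<M))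
    where
    i+gap≡j : suc i + (j ∸ suc i) ≡ j
    i+gap≡j = m+[n∸m]≡n i<j

  colour-far : ∀ {i j} → i ≢ j → i < M → j < M → Far N ∣ colour i - colour j ∣
  colour-far {i} {j} i≢j i<M j<M with <-cmp i j
  ... | tri< i<j _ _ = colour-far-< i<j j<M
  ... | tri≈ _ i≡j _ = ⊥-elim (i≢j i≡j)
  ... | tri> _ _ j<i = subst (Far N) (∣-∣-comm (colour j) (colour i)) (colour-far-< j<i i<M)

⟨$⟩ʳ-injective : ∀ {n} (π : Permutation′ n) {x y} → π ⟨$⟩ʳ x ≡ π ⟨$⟩ʳ y → x ≡ y
⟨$⟩ʳ-injective π π⟨x⟩≡π⟨y⟩ = trans (sym (inverseˡ π)) (trans (cong (π ⟨$⟩ˡ_) π⟨x⟩≡π⟨y⟩) (inverseˡ π))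

transpose-fst : ∀ {n} (i j : Fin n) → transpose i j ⟨$⟩ʳ i ≡ j
transpose-fst i j rewrite dec-true (i Fin.≟ i) refl = refl

transpose-other : ∀ {n} {i j x : Fin n} → x ≢ i → x ≢ j → transpose i j ⟨$⟩ʳ x ≡ x
transpose-other {i = i} {j} {x} x≢i x≢j
  rewrite dec-false (x Fin.≟ i) x≢i | dec-false (x Fin.≟ j) x≢j = refl

two-point-permutation : ∀ {n} {w v s t : Fin n} → w ≢ v → s ≢ t →
  ∃[ π ] (π ⟨$⟩ʳ w ≡ s × π ⟨$⟩ʳ v ≡ t)
two-point-permutation {w = w} {v} {s} {t} w≢v s≢t =
  τ ∘ₚ transpose (τ ⟨$⟩ʳ v) t ,
  trans (cong (transpose (τ ⟨$⟩ʳ v) t ⟨$⟩ʳ_) (transpose-fst w s)) (transpose-other s≢τv s≢t) ,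
  transpose-fst (τ ⟨$⟩ʳ v) t
  where
  τ = transpose w s
  s≢τv : s ≢ τ ⟨$⟩ʳ v
  s≢τv s≡τv = w≢v (⟨$⟩ʳ-injective τ (trans (transpose-fst w s) s≡τv))

ListColouring : (N : ℕ) {M : ℕ} → (Fin M → Fin N) → (Fin M → Fin N) → Set
ListColouring N L f =
  (∀ v → Far N ∣ toℕ (L v) - toℕ (f v) ∣) × (∀ u v → u ≢ v → Far N ∣ toℕ (f u) - toℕ (f v) ∣)

Consecutive : (N : ℕ) → Fin N → Fin N → Set
Consecutive N a b = toℕ b ≡ wrap N (suc (toℕ a))

≢fromℕ⇒suc< : ∀ {m} {i : Fin (suc m)} → i ≢ fromℕ m → suc (toℕ i) < suc m
≢fromℕ⇒suc< {m} {i} i≢last =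
  s≤s (subst (suc (toℕ i) ≤_) (toℕ-fromℕ m) (Finₚ.≤∧≢⇒< (≤fromℕ i) i≢last))

≢zero⇒1≤toℕ : ∀ {n} {i : Fin (suc n)} → i ≢ Fin.zero → 1 ≤ toℕ i
≢zero⇒1≤toℕ {i = Fin.zero}  i≢0 = ⊥-elim (i≢0 refl)
≢zero⇒1≤toℕ {i = Fin.suc _} _   = s≤s z≤n

consecutive-lists-colourable : ∀ {N m} → (2 + m) + (2 + m) < N →
  (L : Fin (2 + m) → Fin N) (P Q : Fin N) → P ≢ Q → Consecutive N P Q →
  (∀ u → L u ≡ P ⊎ L u ≡ Q) → ∃[ w ] L w ≡ P → ∃[ v ] L v ≡ Q →
  ∃[ f ] ListColouring N L f
consecutive-lists-colourable {N} {m} M+M<N L P Q P≢Q PQ-consecutive lists (w , Lw≡P) (v , Lv≡Q)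
  with two-point-permutation {w = w} {v} {Fin.zero} {fromℕ (suc m)} w≢v (λ ())
  where
  w≢v : w ≢ v
  w≢v w≡v = P≢Q (trans (sym Lw≡P) (trans (cong L w≡v) Lv≡Q))
... | π , πw≡first , πv≡last = f , in-list , proper
  where
  open Palette {M = 2 + m} M+M<N (toℕ<n P)

  f : Fin (2 + m) → Fin N
  f u = fromℕ< (colour<N (toℕ<n (π ⟨$⟩ʳ u)))

  lists-differ : ∀ {u u′} → L u ≡ P → L u′ ≡ Q → π ⟨$⟩ʳ u ≢ π ⟨$⟩ʳ u′
  lists-differ Lu≡P Lu′≡Q πu≡πu′ =
    P≢Q (trans (sym Lu≡P) (trans (cong L (⟨$⟩ʳ-injective π πu≡πu′)) Lu′≡Q))

  in-list : ∀ u → Far N ∣ toℕ (L u) - toℕ (f u) ∣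
  in-list u with lists u
  ... | inj₁ Lu≡P rewrite Lu≡P | toℕ-fromℕ< (colour<N (toℕ<n (π ⟨$⟩ʳ u))) =
    colour-far-from-p (≢fromℕ⇒suc< (λ πu≡last → lists-differ Lu≡P Lv≡Q (trans πu≡last (sym πv≡last))))
  ... | inj₂ Lu≡Q rewrite Lu≡Q | toℕ-fromℕ< (colour<N (toℕ<n (π ⟨$⟩ʳ u))) | PQ-consecutive =
    colour-far-from-suc-p
      (≢zero⇒1≤toℕ (λ πu≡first → lists-differ Lw≡P Lu≡Q (trans πw≡first (sym πu≡first))))
      (toℕ<n (π ⟨$⟩ʳ u))

  proper : ∀ u u′ → u ≢ u′ → Far N ∣ toℕ (f u) - toℕ (f u′) ∣
  proper u u′ u≢u′ rewrite toℕ-fromℕ< (colour<N (toℕ<n (π ⟨$⟩ʳ u)))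
                         | toℕ-fromℕ< (colour<N (toℕ<n (π ⟨$⟩ʳ u′))) =
    colour-far (λ eq → u≢u′ (⟨$⟩ʳ-injective π (toℕ-injective eq)))
      (toℕ<n (π ⟨$⟩ʳ u)) (toℕ<n (π ⟨$⟩ʳ u′))

¬far⇒consecutive : ∀ {N} x d → x + d < N → 1 ≤ d → ¬ Far N d →
  x + d ≡ wrap N (suc x) ⊎ x ≡ wrap N (suc (x + d))
¬far⇒consecutive {N} x (suc zero) x+1<N _ _ =
  inj₁ (trans (+-comm x 1) (sym (wrap-< (subst (_< N) (+-comm x 1) x+1<N))))
¬far⇒consecutive {N} x d@(suc (suc _)) x+d<N _ ¬far = inj₂ (begin
  x                      ≡⟨ x≡0 ⟩
  0                      ≡⟨ n∸n≡0 N ⟨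
  N ∸ N                  ≡⟨ wrap-≥ {N} ≤-refl ⟨
  wrap N N               ≡⟨ cong (wrap N) (trans N≡1+d (cong suc (cong (_+ d) (sym x≡0)))) ⟩
  wrap N (suc (x + d))   ∎)
  where
  open ≡-Reasoning
  N≤1+d : N ≤ suc d
  N≤1+d = ≤-trans (m≤n+m∸n N 2) (s≤s (≰⇒> (λ d≤N∸2 → ¬far (s≤s (s≤s z≤n) , d≤N∸2))))
  N≡1+d : N ≡ suc d
  N≡1+d = ≤-antisym N≤1+d (≤-trans (s≤s (m≤n+m d x)) x+d<N)
  x≡0 : x ≡ 0
  x≡0 = n≤0⇒n≡0 (+-cancelʳ-≤ d x 0 (s≤s⁻¹ (subst (suc (x + d) ≤_) N≡1+d x+d<N)))

nonadjacent-<⇒consecutive : ∀ {N} {a b : Fin N} → toℕ a < toℕ b → ¬ Far N ∣ toℕ a - toℕ b ∣ →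
  Consecutive N a b ⊎ Consecutive N b a
nonadjacent-<⇒consecutive {N} {a} {b} a<b ¬far =
  Sum.map (trans (sym a+d≡b)) (λ eq → trans eq (cong (λ y → wrap N (suc y)) a+d≡b))
    (¬far⇒consecutive (toℕ a) (toℕ b ∸ toℕ a) (subst (_< N) (sym a+d≡b) (toℕ<n b))
      (m<n⇒0<n∸m a<b) (λ far-d → ¬far (subst (Far N) (sym (m≤n⇒∣m-n∣≡n∸m (<⇒≤ a<b))) far-d)))
  where
  a+d≡b : toℕ a + (toℕ b ∸ toℕ a) ≡ toℕ b
  a+d≡b = m+[n∸m]≡n (<⇒≤ a<b)

nonadjacent⇒consecutive : ∀ {N} {a b : Fin N} → a ≢ b → ¬ Far N ∣ toℕ a - toℕ b ∣ →
  Consecutive N a b ⊎ Consecutive N b a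
nonadjacent⇒consecutive {N} {a} {b} a≢b ¬far with <-cmp (toℕ a) (toℕ b)
... | tri< a<b _ _ = nonadjacent-<⇒consecutive a<b ¬far
... | tri≈ _ a≡b _ = ⊥-elim (a≢b (toℕ-injective a≡b))
... | tri> _ _ b<a =
  Sum.swap (nonadjacent-<⇒consecutive b<a (¬far ∘ subst (Far N) (∣-∣-comm (toℕ b) (toℕ a))))

palette-fits : ∀ j → (3 + j) + (3 + j) < 2 * (4 + j) ∸ 1
palette-fits j = ≤-reflexive (double-3+j j)
  where
  double-3+j : ∀ j → suc ((3 + j) + (3 + j)) ≡ 3 + (j + ((4 + j) + 0))
  double-3+j = solve-∀

-- For k = 4 + j, LColouring k unfolds to ListColouring (2k - 1): both 2k ∸ 3
-- and (2k ∸ 1) ∸ 2 compute to the same term.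
lemma5p2 : (k : ℕ) → 4 ≤ k →
    (L : Fin (k ∸ 1) → Fin (2 * k ∸ 1)) → NearUniform k L →
    ∃[ f ] LColouring k L f
lemma5p2 (suc (suc (suc zero))) (s≤s (s≤s (s≤s ()))) _ _
lemma5p2 (suc (suc (suc (suc j)))) _ L (a , b , a≢b , a≁b , lists , La , Lb)
  with nonadjacent⇒consecutive a≢b a≁b
... | inj₁ ab = consecutive-lists-colourable (palette-fits j) L a b a≢b ab lists La Lb
... | inj₂ ba = consecutive-lists-colourable (palette-fits j) L b a (a≢b ∘ sym) ba (Sum.swap ∘ lists) Lb La
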